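{- For every integer $q\ge 0$, every minimum $\sigma$-$\tau$ edge cut in the $q$-triangle fractal $\triangle_q$ has size exactly $q+1$.
   Context: The $q$-triangle fractal $\triangle_q$ is the graph built as follows: start with two vertices $\sigma,\tau$ (the special vertices) joined by one edge, which is marked. Then repeat $q$ times: for every currently marked edge $\{a,b\}$ add a new vertex $w$ and the two new edges $\{a,w\},\{w,b\}$, mark these new edges, and unmark all previously marked edges. Equivalently, $\triangle_0$ is the single edge $\sigma\tau$, and $\triangle_q$ is obtained from two copies of $\triangle_{q-1}$ with special vertices $\sigma',\tau'$ and $\sigma'',\tau''$ by identifying $\tau'$ with $\sigma''$ and adding the edge $\{\sigma',\tau''\}$, with $\sigma=\sigma'$, $\tau=\tau''$. An $s$-$t$ edge cut is an edge set whose removal disconnects $s$ from $t$; it is minimum if no $s$-$t$ edge cut has fewer edges. -}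

module Defs where

open import Data.Nat using (ℕ; zero; suc; _+_; _∸_; _≤_)
open import Data.Product using (_×_; _,_)
open import Data.Sum using (_⊎_)
open import Data.List using (List; []; _∷_; _++_; map; length; lookup)
open import Data.Fin using (Fin)
open import Data.Fin.Subset using (Subset; _∉_; ∣_∣)
open import Relation.Binary.PropositionalEquality using (_≡_)
open import Relation.Nullary using (¬_)

-- Vertices are natural-number labels.  In △_q the special vertices are
-- σ = 0 and τ = 1, and the vertex set is {0, …, nV q - 1}.
Vertex : Set
Vertex = ℕ

Edge : Set
Edge = Vertex × Vertex

σ τ : Vertex
σ = 0
τ = 1

nV : ℕ → ℕ
nV zero = 2
nV (suc q) = nV q + nV q ∸ 1

-- Relabelling of the first copy (σ' ↦ 0, τ' ↦ 2 = middle vertex, others shifted)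
relA : ℕ → Vertex → Vertex
relA q 0 = 0
relA q 1 = 2
relA q (suc (suc k)) = suc (suc (suc k))

-- Relabelling of the second copy (σ'' ↦ 2 (identified with τ'), τ'' ↦ 1,
-- others placed after the vertices of the first copy)
relB : ℕ → Vertex → Vertex
relB q 0 = 2
relB q 1 = 1
relB q (suc (suc k)) = suc (suc k) + (nV q ∸ 1)

mapE : (Vertex → Vertex) → Edge → Edge
mapE f (a , b) = f a , f b

-- Edge list of △_q (recursive construction: two copies of △_{q-1},
-- τ' identified with σ'', plus the edge {σ', τ''}).
edges : ℕ → List Edge
edges zero = (σ , τ) ∷ []
edges (suc q) = map (mapE (relA q)) (edges q) ++ map (mapE (relB q)) (edges q) ++ ((σ , τ) ∷ [])

EdgeSet : ℕ → Set
EdgeSet q = Subset (length (edges q))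

Joins : Edge → Vertex → Vertex → Set
Joins (a , b) u w = (a ≡ u × b ≡ w) ⊎ (a ≡ w × b ≡ u)

data Reach (q : ℕ) (C : EdgeSet q) : Vertex → Vertex → Set where
  here : ∀ {u} → Reach q C u u
  step : ∀ {u w v} (i : Fin (length (edges q))) → i ∉ C →
         Joins (lookup (edges q) i) u w → Reach q C w v → Reach q C u v

IsCut : (q : ℕ) → EdgeSet q → Set
IsCut q C = ¬ Reach q C σ τ

IsMinCut : (q : ℕ) → EdgeSet q → Set
IsMinCut q C = IsCut q C × (∀ (D : EdgeSet q) → IsCut q D → ∣ C ∣ ≤ ∣ D ∣)

module Submission where

-- Lower bound (every cut has at least q + 1 edges), by induction on q.
-- △_{q+1} consists of two copies of △_q, glued at the middle vertex 2, plus
-- the direct edge στ.  A cut C of △_{q+1} must contain the direct edge, and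
-- its restriction to at least one copy must be a cut of that copy: otherwise
-- σ reaches 2 in the first copy and 2 reaches τ in the second.  Induction
-- gives that copy at least q + 1 edges of C, so |C| ≥ (q + 1) + 1.
--
-- Upper bound: the star of σ (all edges incident to σ) is a cut of size
-- q + 1; the first copy contributes its own star, the second copy none
-- (σ is not one of its vertices), and the direct edge one more.

open import Defs
open import Data.Nat using (ℕ; zero; suc; _+_; _≤_; s≤s; z≤n; _≡ᵇ_)
open import Data.Nat.Properties using (_≤?_; ≤-antisym; ≤-trans; m≤m+n; m≤n+m; +-suc; +-comm; module ≤-Reasoning)
open import Data.Bool using (Bool; true; false; _∨_)
open import Data.Bool.Properties using (∨-zeroʳ)
open import Data.Fin using (Fin)
import Data.Fin as Fin
open import Data.Fin.Subset using (Subset; ∣_∣; _∉_)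
open import Data.Vec using ([]; _∷_; tabulate)
import Data.Vec as Vec
open import Data.Vec.Properties using (lookup∘tabulate; tabulate∘lookup; tabulate-cong; lookup⇒[]=; []=⇒lookup)
open import Data.List using (List; []; _∷_; _++_; map; length; lookup)
open import Data.Product using (_,_)
open import Data.Sum using (_⊎_; inj₁; inj₂)
open import Data.Empty using (⊥; ⊥-elim)
open import Relation.Nullary using (yes; no)
open import Relation.Binary.PropositionalEquality using (_≡_; refl; sym; trans; cong; cong₂; subst; module ≡-Reasoning)

restrict : {m n : ℕ} → (Fin m → Fin n) → Subset n → Subset m
restrict g C = tabulate (λ i → Vec.lookup C (g i))

restrict-∘ : {l m n : ℕ} (g : Fin l → Fin m) (h : Fin m → Fin n) (C : Subset n) →
             restrict g (restrict h C) ≡ restrict (λ i → h (g i)) C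
restrict-∘ g h C = tabulate-cong λ i → lookup∘tabulate _ (g i)

select : {A : Set} → (A → Bool) → (xs : List A) → Subset (length xs)
select p xs = tabulate (λ i → p (lookup xs i))

∣single∣ : (v : Subset 1) → Vec.lookup v Fin.zero ≡ true → ∣ v ∣ ≡ 1
∣single∣ (true ∷ []) _ = refl

∣none∣ : (n : ℕ) → ∣ tabulate {n = n} (λ _ → false) ∣ ≡ 0
∣none∣ zero    = refl
∣none∣ (suc n) = ∣none∣ n

module _ {A B : Set} (f : A → B) where

  inl : (xs : List A) (ys : List B) → Fin (length xs) → Fin (length (map f xs ++ ys))
  inl (x ∷ xs) ys Fin.zero    = Fin.zero
  inl (x ∷ xs) ys (Fin.suc i) = Fin.suc (inl xs ys i)

  inr : (xs : List A) (ys : List B) → Fin (length ys) → Fin (length (map f xs ++ ys))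
  inr []       ys i = i
  inr (x ∷ xs) ys i = Fin.suc (inr xs ys i)

  lookup-inl : (xs : List A) (ys : List B) (i : Fin (length xs)) →
               lookup (map f xs ++ ys) (inl xs ys i) ≡ f (lookup xs i)
  lookup-inl (x ∷ xs) ys Fin.zero    = refl
  lookup-inl (x ∷ xs) ys (Fin.suc i) = lookup-inl xs ys i

  lookup-inr : (xs : List A) (ys : List B) (i : Fin (length ys)) →
               lookup (map f xs ++ ys) (inr xs ys i) ≡ lookup ys i
  lookup-inr []       ys i = refl
  lookup-inr (x ∷ xs) ys i = lookup-inr xs ys i

  ∣∣-split : (xs : List A) (ys : List B) (C : Subset (length (map f xs ++ ys))) →
             ∣ C ∣ ≡ ∣ restrict (inl xs ys) C ∣ + ∣ restrict (inr xs ys) C ∣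
  ∣∣-split []       ys C           = cong ∣_∣ (sym (tabulate∘lookup C))
  ∣∣-split (x ∷ xs) ys (true  ∷ C) = cong suc (∣∣-split xs ys C)
  ∣∣-split (x ∷ xs) ys (false ∷ C) = ∣∣-split xs ys C

reach-++ : ∀ {q C u w v} → Reach q C u w → Reach q C w v → Reach q C u v
reach-++ here               r′ = r′
reach-++ (step i i∉ join r) r′ = step i i∉ join (reach-++ r r′)

joins-map : (f : Vertex → Vertex) (e : Edge) {u w : Vertex} →
            Joins e u w → Joins (mapE f e) (f u) (f w)
joins-map f (a , b) (inj₁ (refl , refl)) = inj₁ (refl , refl)
joins-map f (a , b) (inj₂ (refl , refl)) = inj₂ (refl , refl)

record Embedding (q r : ℕ) : Set where
  field
    vertex      : Vertex → Vertex
    edge        : Fin (length (edges q)) → Fin (length (edges r))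
    lookup-edge : ∀ i → lookup (edges r) (edge i) ≡ mapE vertex (lookup (edges q) i)

open Embedding

transport : ∀ {q r} (φ : Embedding q r) (C : EdgeSet r) {u v : Vertex} →
            Reach q (restrict (edge φ) C) u v → Reach r C (vertex φ u) (vertex φ v)
transport φ C here = here
transport φ C (step i i∉ join r) =
  step (edge φ i) edge-i∉C
       (subst (λ e → Joins e _ _) (sym (lookup-edge φ i)) (joins-map (vertex φ) _ join))
       (transport φ C r)
  where
  edge-i∉C : edge φ i ∉ C
  edge-i∉C e∈ = i∉ (lookup⇒[]= i _ (trans (lookup∘tabulate _ i) ([]=⇒lookup e∈)))

restrict-select : ∀ {q r} (φ : Embedding q r) (p : Edge → Bool) →
                  restrict (edge φ) (select p (edges r)) ≡ select (λ e → p (mapE (vertex φ) e)) (edges q)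
restrict-select φ p = tabulate-cong λ i →
  trans (lookup∘tabulate _ (edge φ i)) (cong p (lookup-edge φ i))

module Decomposition (q : ℕ) where

  private
    A B : Edge → Edge
    A = mapE (relA q)
    B = mapE (relB q)
    last : List Edge
    last = (σ , τ) ∷ []
    rest : List Edge
    rest = map B (edges q) ++ last
    in-rest : Fin (length rest) → Fin (length (edges (suc q)))
    in-rest = inr A (edges q) rest

  first : Embedding q (suc q)
  first = record
    { vertex      = relA q
    ; edge        = inl A (edges q) rest
    ; lookup-edge = lookup-inl A (edges q) rest
    }

  second : Embedding q (suc q)
  second = record
    { vertex      = relB q
    ; edge        = λ i → in-rest (inl B (edges q) last i)
    ; lookup-edge = λ i → trans (lookup-inr A (edges q) rest _) (lookup-inl B (edges q) last i)
    }

  direct : Fin 1 → Fin (length (edges (suc q)))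
  direct i = in-rest (inr B (edges q) last i)

  lookup-direct : lookup (edges (suc q)) (direct Fin.zero) ≡ (σ , τ)
  lookup-direct = trans (lookup-inr A (edges q) rest _) (lookup-inr B (edges q) last Fin.zero)

  ∣∣-decompose : (C : EdgeSet (suc q)) →
                 ∣ C ∣ ≡ ∣ restrict (edge first) C ∣ + (∣ restrict (edge second) C ∣ + ∣ restrict direct C ∣)
  ∣∣-decompose C = begin
    ∣ C ∣
      ≡⟨ ∣∣-split A (edges q) rest C ⟩
    ∣ C₁ ∣ + ∣ C-rest ∣
      ≡⟨ cong (∣ C₁ ∣ +_) (∣∣-split B (edges q) last C-rest) ⟩
    ∣ C₁ ∣ + (∣ restrict (inl B (edges q) last) C-rest ∣ + ∣ restrict (inr B (edges q) last) C-rest ∣)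
      ≡⟨ cong₂ (λ D E → ∣ C₁ ∣ + (∣ D ∣ + ∣ E ∣)) (restrict-∘ (inl B (edges q) last) in-rest C)
                                                 (restrict-∘ (inr B (edges q) last) in-rest C) ⟩
    ∣ C₁ ∣ + (∣ restrict (edge second) C ∣ + ∣ restrict direct C ∣) ∎
    where
    open ≡-Reasoning
    C₁ : EdgeSet q
    C₁ = restrict (edge first) C
    C-rest : Subset (length rest)
    C-rest = restrict in-rest C

module _ (q : ℕ) (C : EdgeSet (suc q)) (cut : IsCut (suc q) C) where
  open Decomposition q

  cut-has-direct : Vec.lookup C (direct Fin.zero) ≡ true
  cut-has-direct with Vec.lookup C (direct Fin.zero) in eq
  ... | true  = refl
  ... | false = ⊥-elim (cut (step (direct Fin.zero) direct∉C direct-joins here))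
    where
    direct∉C : direct Fin.zero ∉ C
    direct∉C d∈ with trans (sym ([]=⇒lookup d∈)) eq
    ... | ()
    direct-joins : Joins (lookup (edges (suc q)) (direct Fin.zero)) σ τ
    direct-joins rewrite lookup-direct = inj₁ (refl , refl)

  -- C restricts to a cut of the first or of the second copy (stated
  -- negatively: a σ-2 path and a 2-τ path cannot both survive).
  cut-splits : Reach q (restrict (edge first) C) σ τ → Reach q (restrict (edge second) C) σ τ → ⊥
  cut-splits r₁ r₂ = cut (reach-++ (transport first C r₁) (transport second C r₂))

one-large-part : {q a b : ℕ} → suc q ≤ a ⊎ suc q ≤ b → suc (suc q) ≤ a + (b + 1)
one-large-part {q} {a} {b} large = begin
  suc (suc q)  ≤⟨ s≤s (part≤sum large) ⟩
  suc (a + b)  ≡⟨ sym (+-suc a b) ⟩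
  a + suc b    ≡⟨ cong (a +_) (+-comm 1 b) ⟩
  a + (b + 1)  ∎
  where
  open ≤-Reasoning
  part≤sum : suc q ≤ a ⊎ suc q ≤ b → suc q ≤ a + b
  part≤sum (inj₁ q<a) = ≤-trans q<a (m≤m+n a b)
  part≤sum (inj₂ q<b) = ≤-trans q<b (m≤n+m b a)

cut-lower-bound : (q : ℕ) (C : EdgeSet q) → IsCut q C → suc q ≤ ∣ C ∣
cut-lower-bound zero (true  ∷ []) cut = s≤s z≤n
cut-lower-bound zero (false ∷ []) cut = ⊥-elim (cut (step Fin.zero (λ ()) (inj₁ (refl , refl)) here))
cut-lower-bound (suc q) C cut
  rewrite Decomposition.∣∣-decompose q C
        | ∣single∣ (restrict (Decomposition.direct q) C) (cut-has-direct q C cut)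
  = one-large-part large-copy
  where
  open Decomposition q
  C₁ C₂ : EdgeSet q
  C₁ = restrict (edge first) C
  C₂ = restrict (edge second) C
  -- Decided by size: if both copies were small, neither would be a cut.
  large-copy : suc q ≤ ∣ C₁ ∣ ⊎ suc q ≤ ∣ C₂ ∣
  large-copy with suc q ≤? ∣ C₁ ∣ | suc q ≤? ∣ C₂ ∣
  ... | yes large₁ | _          = inj₁ large₁
  ... | no _       | yes large₂ = inj₂ large₂
  ... | no small₁  | no small₂  =
    ⊥-elim (small₁ (cut-lower-bound q C₁ λ r₁ →
            small₂ (cut-lower-bound q C₂ λ r₂ → cut-splits q C cut r₁ r₂)))

at-σ : Edge → Bool
at-σ (a , b) = (a ≡ᵇ σ) ∨ (b ≡ᵇ σ)

joins-σ : (e : Edge) {w : Vertex} → Joins e σ w → at-σ e ≡ true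
joins-σ (a , b) (inj₁ (refl , refl)) = refl
joins-σ (a , b) (inj₂ (refl , refl)) = ∨-zeroʳ (a ≡ᵇ σ)

relA-at-σ : (q : ℕ) (e : Edge) → at-σ (mapE (relA q) e) ≡ at-σ e
relA-at-σ q (a , b) = cong₂ _∨_ (fixes a) (fixes b)
  where
  fixes : (v : Vertex) → (relA q v ≡ᵇ σ) ≡ (v ≡ᵇ σ)
  fixes 0             = refl
  fixes 1             = refl
  fixes (suc (suc v)) = refl

relB-at-σ : (q : ℕ) (e : Edge) → at-σ (mapE (relB q) e) ≡ false
relB-at-σ q (a , b) = cong₂ _∨_ (avoids a) (avoids b)
  where
  avoids : (v : Vertex) → (relB q v ≡ᵇ σ) ≡ false
  avoids 0             = refl
  avoids 1             = refl
  avoids (suc (suc v)) = refl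

star : (q : ℕ) → EdgeSet q
star q = select at-σ (edges q)

star-is-cut : (q : ℕ) → IsCut q (star q)
star-is-cut q (step i i∉ join _) =
  i∉ (lookup⇒[]= i _ (trans (lookup∘tabulate _ i) (joins-σ _ join)))

-- The star of σ in △_{q+1} is the star in the first copy plus the direct edge.
star-size : (q : ℕ) → ∣ star q ∣ ≡ suc q
star-size zero    = refl
star-size (suc q) = begin
  ∣ star (suc q) ∣
    ≡⟨ ∣∣-decompose (star (suc q)) ⟩
  ∣ restrict (edge first) (star (suc q)) ∣ + (∣ restrict (edge second) (star (suc q)) ∣ + ∣ restrict direct (star (suc q)) ∣)
    ≡⟨ cong₂ _+_ first-part (cong₂ _+_ second-part direct-part) ⟩
  suc q + (0 + 1)
    ≡⟨ +-comm (suc q) 1 ⟩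
  suc (suc q) ∎
  where
  open ≡-Reasoning
  open Decomposition q
  first-part : ∣ restrict (edge first) (star (suc q)) ∣ ≡ suc q
  first-part = trans (cong ∣_∣ (trans (restrict-select first at-σ) (tabulate-cong λ i → relA-at-σ q (lookup (edges q) i))))
                     (star-size q)
  second-part : ∣ restrict (edge second) (star (suc q)) ∣ ≡ 0
  second-part = trans (cong ∣_∣ (trans (restrict-select second at-σ) (tabulate-cong λ i → relB-at-σ q (lookup (edges q) i))))
                      (∣none∣ (length (edges q)))
  direct-part : ∣ restrict direct (star (suc q)) ∣ ≡ 1
  direct-part = ∣single∣ (restrict direct (star (suc q))) (trans (lookup∘tabulate _ (direct Fin.zero)) (cong at-σ lookup-direct))

lemma4 : (q : ℕ) (C : EdgeSet q) → IsMinCut q C → ∣ C ∣ ≡ suc q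
lemma4 q C (cut , minimal) = ≤-antisym at-most-star (cut-lower-bound q C cut)
  where
  open ≤-Reasoning
  at-most-star : ∣ C ∣ ≤ suc q
  at-most-star = begin
    ∣ C ∣        ≤⟨ minimal (star q) (star-is-cut q) ⟩
    ∣ star q ∣   ≡⟨ star-size q ⟩
    suc q        ∎
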